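{- Let $A$ be a positive quasi-Cartan matrix. Then (a) $0\le A_{ij}A_{ji}\le 3$ for all $i\ne j$; and (b) $A_{ik}A_{kj}A_{ji}\ge 0$ for all pairwise distinct $i,j,k$.
   Context: A quasi-Cartan matrix is a square integer matrix $A$ with all diagonal entries equal to $2$ such that $DA$ is symmetric for some diagonal matrix $D$ with positive diagonal entries; it is positive if $DA$ is positive definite (equivalently, all principal minors of $A$ are positive).
   Formalization: The diagonal matrix $D$ has positive rational entries, and positive definiteness of $DA$ is tested on vectors with rational coordinates. -}

module Defs where

open import Data.Nat using (ℕ; zero; suc)
open import Data.Fin using (Fin; zero; suc)
open import Data.Integer as ℤ using (ℤ; +_)
open import Data.Rational as ℚ using (ℚ; 0ℚ; _/_)
open import Data.Product using (Σ; _×_; ∃)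
open import Relation.Binary.PropositionalEquality using (_≡_)
open import Relation.Nullary using (¬_)

Matrix : ℕ → Set
Matrix n = Fin n → Fin n → ℤ

toℚ : ℤ → ℚ
toℚ z = z / 1

Σ[_] : ∀ {n} → (Fin n → ℚ) → ℚ
Σ[_] {zero}  f = 0ℚ
Σ[_] {suc n} f = f zero ℚ.+ Σ[_] {n} (λ i → f (suc i))

quadForm : ∀ {n} → (d : Fin n → ℚ) → Matrix n → (Fin n → ℚ) → ℚ
quadForm d A x = Σ[ (λ i → Σ[ (λ j → x i ℚ.* (d i ℚ.* toℚ (A i j)) ℚ.* x j) ] ) ]

SymmetrizedBy : ∀ {n} → (Fin n → ℚ) → Matrix n → Set
SymmetrizedBy d A = ∀ i j → d i ℚ.* toℚ (A i j) ≡ d j ℚ.* toℚ (A j i)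

PosDef : ∀ {n} → (Fin n → ℚ) → Matrix n → Set
PosDef {n} d A = ∀ (x : Fin n → ℚ) → ¬ (∀ i → x i ≡ 0ℚ) → 0ℚ ℚ.< quadForm d A x

IsQuasiCartanWith : ∀ {n} → (Fin n → ℚ) → Matrix n → Set
IsQuasiCartanWith d A = (∀ i → A i i ≡ + 2) × (∀ i → 0ℚ ℚ.< d i) × SymmetrizedBy d A

PositiveQuasiCartan : ∀ {n} → Matrix n → Set
PositiveQuasiCartan {n} A =
  Σ (Fin n → ℚ) (λ d → IsQuasiCartanWith d A × PosDef d A)

{-# OPTIONS --safe #-}
module Submission where

-- Positivity of D A passes to principal submatrices (evaluate the form on vectors supported on
-- the chosen indices), so it suffices to treat 2 × 2 and 3 × 3 matrices, where D A is symmetric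
-- with diagonal 2 d.  For a pair, d i A i j = d j A j i makes A i j A j i a positive multiple of
-- a square, and the vector (A₀₁, -2) has form value 2 d₁ (4 - A₀₁ A₁₀) > 0.  For a triple whose
-- cycle A₀₂ A₂₁ A₁₀ is negative, pick units r, q with r A₀₂ ≤ -1 and q A₁₀ ≤ -1.  As
-- q² = r² = 1, the product (r A₀₂) (q A₁₀) (q r A₂₁) is that cycle, so q r A₂₁ is a negative
-- integer, hence ≤ -1, and the vector (1, q, r) has form value
-- 2 (d₀ (1 + r A₀₂) + d₁ (1 + q A₁₀) + d₂ (1 + q r A₂₁)) ≤ 0.

open import Defs
open import Data.Nat using (ℕ)
open import Data.Fin using (Fin)
open import Data.Integer using (ℤ; +_; _*_; _≤_)
open import Data.Product using (_×_)
open import Relation.Binary.PropositionalEquality using (_≢_)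

open import Algebra.Bundles using (Ring)
open import Data.Empty using (⊥-elim)
open import Data.Fin using (zero; suc; _≟_)
open import Data.Fin.Patterns using (0F; 1F; 2F)
import Data.Integer as ℤ
open import Data.Integer
  using (0ℤ; 1ℤ; -1ℤ; _+_; _-_; -_; _<_; ∣_∣; +0; +[1+_]; -[1+_]; +≤+; -≤-; -≤+)
import Data.Integer.Properties as ℤₚ
import Data.Integer.Tactic.RingSolver as ℤ-Solver
import Data.List as List
open import Data.Nat using (zero; suc; z≤n)
open import Data.Nat.Coprimality using (1-coprimeTo) renaming (sym to coprime-sym)
open import Data.Product using (_,_; ∃-syntax; ∃₂)
import Data.Rational as ℚ
open import Data.Rational using (ℚ; 0ℚ; 1ℚ; mkℚ; _/_)
import Data.Rational.Properties as ℚₚ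
open import Data.Vec.Functional using ([]; _∷_)
open import Function using (_∘_)
open import Function.Definitions using (Injective)
open import Level using (0ℓ)
open import Relation.Binary.PropositionalEquality
  using (_≡_; refl; sym; trans; cong; cong₂; subst; subst₂; module ≡-Reasoning)
open import Relation.Nullary using (¬_; yes; no)
open import Relation.Nullary.Decidable using (dec⇒maybe)
open import Tactic.RingSolver using (solve; solve-∀)
open import Tactic.RingSolver.Core.AlmostCommutativeRing
  using (AlmostCommutativeRing; fromCommutativeRing)

open import Algebra.Properties.Semiring.Sum (Ring.semiring ℚₚ.+-*-ring)
  using (sum; sum-cong-≗; ∑-comm; *-distribˡ-sum; *-distribʳ-sum)

ℚ-ring : AlmostCommutativeRing 0ℓ 0ℓ
ℚ-ring = fromCommutativeRing ℚₚ.+-*-commutativeRing (λ x → dec⇒maybe (0ℚ ℚₚ.≟ x))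

toℚ≡mkℚ : ∀ z → toℚ z ≡ mkℚ z 0 (coprime-sym (1-coprimeTo ∣ z ∣))
toℚ≡mkℚ z = ℚₚ.↥p/↧p≡p (mkℚ z 0 (coprime-sym (1-coprimeTo ∣ z ∣)))

toℚ-homo-+ : ∀ a b → toℚ (a + b) ≡ toℚ a ℚ.+ toℚ b
toℚ-homo-+ a b rewrite toℚ≡mkℚ a | toℚ≡mkℚ b =
  cong (_/ 1) (cong₂ _+_ (sym (ℤₚ.*-identityʳ a)) (sym (ℤₚ.*-identityʳ b)))

toℚ-homo-* : ∀ a b → toℚ (a * b) ≡ toℚ a ℚ.* toℚ b
toℚ-homo-* a b rewrite toℚ≡mkℚ a | toℚ≡mkℚ b = refl

toℚ-homo‿- : ∀ a → toℚ (- a) ≡ ℚ.- toℚ a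
toℚ-homo‿- +0       = refl
toℚ-homo‿- +[1+ n ] = refl
toℚ-homo‿- -[1+ n ] = sym (⁻¹-involutive (toℚ +[1+ n ]))
  where open import Algebra.Properties.Group ℚₚ.+-0-group using (⁻¹-involutive)

toℚ-homo-- : ∀ a b → toℚ (a - b) ≡ toℚ a ℚ.- toℚ b
toℚ-homo-- a b = trans (toℚ-homo-+ a (- b)) (cong (toℚ a ℚ.+_) (toℚ-homo‿- b))

toℚ-mono-≤ : ∀ {a b} → a ≤ b → toℚ a ℚ.≤ toℚ b
toℚ-mono-≤ {a} {b} a≤b rewrite toℚ≡mkℚ a | toℚ≡mkℚ b =
  ℚ.*≤* (subst₂ _≤_ (sym (ℤₚ.*-identityʳ a)) (sym (ℤₚ.*-identityʳ b)) a≤b)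

toℚ-cancel-≤ : ∀ {a b} → toℚ a ℚ.≤ toℚ b → a ≤ b
toℚ-cancel-≤ {a} {b} le rewrite toℚ≡mkℚ a | toℚ≡mkℚ b with le
... | ℚ.*≤* a≤b = subst₂ _≤_ (ℤₚ.*-identityʳ a) (ℤₚ.*-identityʳ b) a≤b

pos*toℚ-nonNeg : ∀ {w z} → 0ℚ ℚ.< w → 0ℤ ≤ z → 0ℚ ℚ.≤ w ℚ.* toℚ z
pos*toℚ-nonNeg {w} {z} w>0 z≥0 = subst (ℚ._≤ w ℚ.* toℚ z) (ℚₚ.*-zeroʳ w)
  (ℚₚ.*-monoˡ-≤-nonNeg w {{ℚ.nonNegative (ℚₚ.<⇒≤ w>0)}} (toℚ-mono-≤ z≥0))

pos*toℚ-nonPos : ∀ {w z} → 0ℚ ℚ.< w → z ≤ 0ℤ → w ℚ.* toℚ z ℚ.≤ 0ℚ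
pos*toℚ-nonPos {w} {z} w>0 z≤0 = subst (w ℚ.* toℚ z ℚ.≤_) (ℚₚ.*-zeroʳ w)
  (ℚₚ.*-monoˡ-≤-nonNeg w {{ℚ.nonNegative (ℚₚ.<⇒≤ w>0)}} (toℚ-mono-≤ z≤0))

pos*toℚ-nonNeg⁻¹ : ∀ {w z} → 0ℚ ℚ.< w → 0ℚ ℚ.≤ w ℚ.* toℚ z → 0ℤ ≤ z
pos*toℚ-nonNeg⁻¹ {w} {z} w>0 wz≥0 = toℚ-cancel-≤ (ℚₚ.*-cancelˡ-≤-pos w {{ℚ.positive w>0}}
  (subst (ℚ._≤ w ℚ.* toℚ z) (sym (ℚₚ.*-zeroʳ w)) wz≥0))

0≤i*i : ∀ i → 0ℤ ≤ i * i
0≤i*i +0       = +≤+ z≤n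
0≤i*i +[1+ n ] = +≤+ z≤n
0≤i*i -[1+ n ] = +≤+ z≤n

Σ≡sum : ∀ {n} (f : Fin n → ℚ) → Σ[ f ] ≡ sum f
Σ≡sum {zero}  f = refl
Σ≡sum {suc n} f = cong (f zero ℚ.+_) (Σ≡sum (f ∘ suc))

quadForm≡sum : ∀ {n} (d : Fin n → ℚ) (A : Matrix n) (x : Fin n → ℚ) →
  quadForm d A x ≡ sum (λ i → sum (λ j → x i ℚ.* (d i ℚ.* toℚ (A i j)) ℚ.* x j))
quadForm≡sum d A x = trans (Σ≡sum (λ i → Σ[ term i ])) (sum-cong-≗ (λ i → Σ≡sum (term i)))
  where
  term : Fin _ → Fin _ → ℚ
  term i j = x i ℚ.* (d i ℚ.* toℚ (A i j)) ℚ.* x j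

δ : ∀ {n} → Fin n → Fin n → ℚ
δ zero    zero    = 1ℚ
δ zero    (suc _) = 0ℚ
δ (suc _) zero    = 0ℚ
δ (suc i) (suc j) = δ i j

δ-refl : ∀ {n} (i : Fin n) → δ i i ≡ 1ℚ
δ-refl zero    = refl
δ-refl (suc i) = δ-refl i

δ-≢ : ∀ {n} {i j : Fin n} → i ≢ j → δ i j ≡ 0ℚ
δ-≢ {i = zero}  {zero}  i≢j = ⊥-elim (i≢j refl)
δ-≢ {i = zero}  {suc j} _   = refl
δ-≢ {i = suc i} {zero}  _   = refl
δ-≢ {i = suc i} {suc j} i≢j = δ-≢ (i≢j ∘ cong suc)

δ-sym : ∀ {n} (i j : Fin n) → δ i j ≡ δ j i
δ-sym zero    zero    = refl
δ-sym zero    (suc j) = refl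
δ-sym (suc i) zero    = refl
δ-sym (suc i) (suc j) = δ-sym i j

δ-injective : ∀ {m n} {ι : Fin m → Fin n} → Injective _≡_ _≡_ ι →
  ∀ s t → δ (ι s) (ι t) ≡ δ s t
δ-injective {ι = ι} ι-inj s t with s ≟ t
... | yes refl = trans (δ-refl (ι s)) (sym (δ-refl s))
... | no s≢t   = trans (δ-≢ (s≢t ∘ ι-inj)) (sym (δ-≢ s≢t))

sum-δ : ∀ {n} (i : Fin n) (g : Fin n → ℚ) → sum (λ l → δ i l ℚ.* g l) ≡ g i
sum-δ zero g = begin
  1ℚ ℚ.* g zero ℚ.+ sum (λ l → 0ℚ ℚ.* g (suc l))
    ≡⟨ cong₂ ℚ._+_ (ℚₚ.*-identityˡ (g zero)) (sym (*-distribˡ-sum 0ℚ (g ∘ suc))) ⟩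
  g zero ℚ.+ 0ℚ ℚ.* sum (g ∘ suc)
    ≡⟨ cong (g zero ℚ.+_) (ℚₚ.*-zeroˡ (sum (g ∘ suc))) ⟩
  g zero ℚ.+ 0ℚ
    ≡⟨ ℚₚ.+-identityʳ (g zero) ⟩
  g zero ∎
  where open ≡-Reasoning
sum-δ (suc i) g = begin
  0ℚ ℚ.* g zero ℚ.+ sum (λ l → δ i l ℚ.* g (suc l))
    ≡⟨ cong₂ ℚ._+_ (ℚₚ.*-zeroˡ (g zero)) (sum-δ i (g ∘ suc)) ⟩
  0ℚ ℚ.+ g (suc i)
    ≡⟨ ℚₚ.+-identityˡ (g (suc i)) ⟩
  g (suc i) ∎
  where open ≡-Reasoning

*-rearrange : ∀ a b e → a ℚ.* (b ℚ.* e) ≡ b ℚ.* (e ℚ.* a)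
*-rearrange a b e = trans (ℚₚ.*-comm a (b ℚ.* e)) (ℚₚ.*-assoc b e a)

submatrix : ∀ {m n} → (Fin m → Fin n) → Matrix n → Matrix m
submatrix ι A s t = A (ι s) (ι t)

extend : ∀ {m n} → (Fin m → Fin n) → (Fin m → ℚ) → Fin n → ℚ
extend ι c l = sum (λ s → δ l (ι s) ℚ.* c s)

extend-∘ : ∀ {m n} {ι : Fin m → Fin n} → Injective _≡_ _≡_ ι →
  ∀ (c : Fin m → ℚ) s → extend ι c (ι s) ≡ c s
extend-∘ ι-inj c s =
  trans (sum-cong-≗ (λ t → cong (ℚ._* c t) (δ-injective ι-inj s t))) (sum-δ s c)

sum-extend : ∀ {m n} (ι : Fin m → Fin n) (c : Fin m → ℚ) (g : Fin n → ℚ) →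
  sum (λ l → extend ι c l ℚ.* g l) ≡ sum (λ s → c s ℚ.* g (ι s))
sum-extend ι c g = begin
  sum (λ l → extend ι c l ℚ.* g l)
    ≡⟨ sum-cong-≗ (λ l → *-distribʳ-sum (g l) (λ s → δ l (ι s) ℚ.* c s)) ⟩
  sum (λ l → sum (λ s → δ l (ι s) ℚ.* c s ℚ.* g l))
    ≡⟨ ∑-comm (λ l s → δ l (ι s) ℚ.* c s ℚ.* g l) ⟩
  sum (λ s → sum (λ l → δ l (ι s) ℚ.* c s ℚ.* g l))
    ≡⟨ sum-cong-≗ (λ s → sum-cong-≗ (λ l → pull-out (c s) (ι s) l)) ⟩
  sum (λ s → sum (λ l → c s ℚ.* (δ (ι s) l ℚ.* g l)))
    ≡⟨ sum-cong-≗ (λ s → *-distribˡ-sum (c s) (λ l → δ (ι s) l ℚ.* g l)) ⟨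
  sum (λ s → c s ℚ.* sum (λ l → δ (ι s) l ℚ.* g l))
    ≡⟨ sum-cong-≗ (λ s → cong (c s ℚ.*_) (sum-δ (ι s) g)) ⟩
  sum (λ s → c s ℚ.* g (ι s)) ∎
  where
  open ≡-Reasoning
  pull-out : ∀ a i l → δ l i ℚ.* a ℚ.* g l ≡ a ℚ.* (δ i l ℚ.* g l)
  pull-out a i l = begin
    δ l i ℚ.* a ℚ.* g l   ≡⟨ ℚₚ.*-assoc (δ l i) a (g l) ⟩
    δ l i ℚ.* (a ℚ.* g l) ≡⟨ *-rearrange (δ l i) a (g l) ⟩
    a ℚ.* (g l ℚ.* δ l i) ≡⟨ cong (a ℚ.*_) (ℚₚ.*-comm (g l) (δ l i)) ⟩
    a ℚ.* (δ l i ℚ.* g l) ≡⟨ cong (λ e → a ℚ.* (e ℚ.* g l)) (δ-sym l i) ⟩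
    a ℚ.* (δ i l ℚ.* g l) ∎

quadForm-extend : ∀ {m n} (d : Fin n → ℚ) (A : Matrix n) (ι : Fin m → Fin n) (c : Fin m → ℚ) →
  quadForm d A (extend ι c) ≡ quadForm (d ∘ ι) (submatrix ι A) c
quadForm-extend d A ι c = begin
  quadForm d A x
    ≡⟨ quadForm≡sum d A x ⟩
  sum (λ l → sum (λ m → x l ℚ.* B l m ℚ.* x m))
    ≡⟨ sum-cong-≗ inner ⟩
  sum (λ l → sum (λ t → x l ℚ.* (B l (ι t) ℚ.* c t)))
    ≡⟨ ∑-comm (λ l t → x l ℚ.* (B l (ι t) ℚ.* c t)) ⟩
  sum (λ t → sum (λ l → x l ℚ.* (B l (ι t) ℚ.* c t)))
    ≡⟨ sum-cong-≗ outer ⟩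
  sum (λ t → sum (λ s → c s ℚ.* B (ι s) (ι t) ℚ.* c t))
    ≡⟨ ∑-comm (λ t s → c s ℚ.* B (ι s) (ι t) ℚ.* c t) ⟩
  sum (λ s → sum (λ t → c s ℚ.* B (ι s) (ι t) ℚ.* c t))
    ≡⟨ quadForm≡sum (d ∘ ι) (submatrix ι A) c ⟨
  quadForm (d ∘ ι) (submatrix ι A) c ∎
  where
  open ≡-Reasoning
  x = extend ι c
  B : Fin _ → Fin _ → ℚ
  B l m = d l ℚ.* toℚ (A l m)
  inner : ∀ l → sum (λ m → x l ℚ.* B l m ℚ.* x m) ≡ sum (λ t → x l ℚ.* (B l (ι t) ℚ.* c t))
  inner l = begin
    sum (λ m → x l ℚ.* B l m ℚ.* x m)
      ≡⟨ sum-cong-≗ (λ m → ℚₚ.*-comm (x l ℚ.* B l m) (x m)) ⟩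
    sum (λ m → x m ℚ.* (x l ℚ.* B l m))
      ≡⟨ sum-extend ι c (λ m → x l ℚ.* B l m) ⟩
    sum (λ t → c t ℚ.* (x l ℚ.* B l (ι t)))
      ≡⟨ sum-cong-≗ (λ t → *-rearrange (c t) (x l) (B l (ι t))) ⟩
    sum (λ t → x l ℚ.* (B l (ι t) ℚ.* c t)) ∎
  outer : ∀ t → sum (λ l → x l ℚ.* (B l (ι t) ℚ.* c t)) ≡ sum (λ s → c s ℚ.* B (ι s) (ι t) ℚ.* c t)
  outer t = begin
    sum (λ l → x l ℚ.* (B l (ι t) ℚ.* c t))
      ≡⟨ sum-extend ι c (λ l → B l (ι t) ℚ.* c t) ⟩
    sum (λ s → c s ℚ.* (B (ι s) (ι t) ℚ.* c t))
      ≡⟨ sum-cong-≗ (λ s → ℚₚ.*-assoc (c s) (B (ι s) (ι t)) (c t)) ⟨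
    sum (λ s → c s ℚ.* B (ι s) (ι t) ℚ.* c t) ∎

PosDef-submatrix : ∀ {m n} (d : Fin n → ℚ) (A : Matrix n) {ι : Fin m → Fin n} →
  Injective _≡_ _≡_ ι → PosDef d A → PosDef (d ∘ ι) (submatrix ι A)
PosDef-submatrix d A {ι} ι-inj posDef c c≢0 =
  subst (0ℚ ℚ.<_) (quadForm-extend d A ι c) (posDef (extend ι c) extend≢0)
  where
  extend≢0 : ¬ (∀ l → extend ι c l ≡ 0ℚ)
  extend≢0 extend≡0 = c≢0 (λ s → trans (sym (extend-∘ ι-inj c s)) (extend≡0 (ι s)))

PositiveQuasiCartan-submatrix : ∀ {m n} (A : Matrix n) {ι : Fin m → Fin n} →
  Injective _≡_ _≡_ ι → PositiveQuasiCartan A → PositiveQuasiCartan (submatrix ι A)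
PositiveQuasiCartan-submatrix A {ι} ι-inj (d , (diag , d>0 , symm) , posDef) =
  d ∘ ι , (diag ∘ ι , d>0 ∘ ι , (λ s t → symm (ι s) (ι t))) , PosDef-submatrix d A ι-inj posDef

[]-injective : ∀ {n} → Injective _≡_ _≡_ ([] {A = Fin n})
[]-injective {x = ()}

∷-injective : ∀ {m n} {i : Fin n} {ι : Fin m → Fin n} →
  (∀ s → ι s ≢ i) → Injective _≡_ _≡_ ι → Injective _≡_ _≡_ (i ∷ ι)
∷-injective i∉ι ι-inj {zero}  {zero}  _ = refl
∷-injective i∉ι ι-inj {zero}  {suc t} e = ⊥-elim (i∉ι t (sym e))
∷-injective i∉ι ι-inj {suc s} {zero}  e = ⊥-elim (i∉ι s e)
∷-injective i∉ι ι-inj {suc s} {suc t} e = cong suc (ι-inj e)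

symmetrizable⇒0≤AᵢⱼAⱼᵢ : ∀ {n} {d : Fin n → ℚ} (A : Matrix n) →
  (∀ i → 0ℚ ℚ.< d i) → SymmetrizedBy d A → ∀ i j → + 0 ≤ A i j * A j i
symmetrizable⇒0≤AᵢⱼAⱼᵢ {d = d} A d>0 symm i j = pos*toℚ-nonNeg⁻¹ (d>0 i)
  (subst (0ℚ ℚ.≤_) (sym weighted) (pos*toℚ-nonNeg (d>0 j) (0≤i*i (A j i))))
  where
  open ≡-Reasoning
  a = toℚ (A i j)
  b = toℚ (A j i)
  weighted : d i ℚ.* toℚ (A i j * A j i) ≡ d j ℚ.* toℚ (A j i * A j i)
  weighted = begin
    d i ℚ.* toℚ (A i j * A j i) ≡⟨ cong (d i ℚ.*_) (toℚ-homo-* (A i j) (A j i)) ⟩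
    d i ℚ.* (a ℚ.* b)           ≡⟨ ℚₚ.*-assoc (d i) a b ⟨
    d i ℚ.* a ℚ.* b             ≡⟨ cong (ℚ._* b) (symm i j) ⟩
    d j ℚ.* b ℚ.* b             ≡⟨ ℚₚ.*-assoc (d j) b b ⟩
    d j ℚ.* (b ℚ.* b)           ≡⟨ cong (d j ℚ.*_) (toℚ-homo-* (A j i) (A j i)) ⟨
    d j ℚ.* toℚ (A j i * A j i) ∎

-- The left-hand side is quadForm d A (a ∷ -2 ∷ []) unfolded, for a 2 × 2 matrix with diagonal
-- entries t₀, t₁ (as rationals) and off-diagonal entries a, b.
form₂-identity : ∀ (d₀ d₁ a b t₀ t₁ : ℚ) → t₀ ≡ toℚ (+ 2) → t₁ ≡ toℚ (+ 2) →
  (a ℚ.* (d₀ ℚ.* t₀) ℚ.* a ℚ.+ (a ℚ.* (d₀ ℚ.* a) ℚ.* (ℚ.- toℚ (+ 2)) ℚ.+ 0ℚ))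
  ℚ.+ ((ℚ.- toℚ (+ 2) ℚ.* (d₁ ℚ.* b) ℚ.* a
        ℚ.+ (ℚ.- toℚ (+ 2) ℚ.* (d₁ ℚ.* t₁) ℚ.* (ℚ.- toℚ (+ 2)) ℚ.+ 0ℚ)) ℚ.+ 0ℚ)
  ≡ (d₁ ℚ.+ d₁) ℚ.* (toℚ (+ 4) ℚ.- a ℚ.* b)
form₂-identity d₀ d₁ a b _ _ refl refl =
  solve (d₀ List.∷ d₁ List.∷ a List.∷ b List.∷ List.[]) ℚ-ring

positive₂⇒A₀₁A₁₀≤3 : (A : Matrix 2) → PositiveQuasiCartan A → A 0F 1F * A 1F 0F ≤ + 3
positive₂⇒A₀₁A₁₀≤3 A (d , (diag , d>0 , _) , posDef) = ℤₚ.≮⇒≥ λ 3<A₀₁A₁₀ →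
  ℚₚ.<-irrefl refl (ℚₚ.<-≤-trans (posDef x x≢0) (subst (ℚ._≤ 0ℚ) (sym form)
    (pos*toℚ-nonPos (ℚₚ.+-mono-< (d>0 1F) (d>0 1F)) (ℤₚ.i≤j⇒i-j≤0 (ℤₚ.i<j⇒suc[i]≤j 3<A₀₁A₁₀)))))
  where
  x : Fin 2 → ℚ
  x = toℚ (A 0F 1F) ∷ ℚ.- toℚ (+ 2) ∷ []
  x≢0 : ¬ (∀ s → x s ≡ 0ℚ)
  x≢0 x≡0 with x≡0 1F
  ... | ()
  form : quadForm d A x ≡ (d 1F ℚ.+ d 1F) ℚ.* toℚ (+ 4 - A 0F 1F * A 1F 0F)
  form = trans
    (form₂-identity (d 0F) (d 1F) (toℚ (A 0F 1F)) (toℚ (A 1F 0F)) _ _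
      (cong toℚ (diag 0F)) (cong toℚ (diag 1F)))
    (cong ((d 1F ℚ.+ d 1F) ℚ.*_) (sym (trans (toℚ-homo-- (+ 4) (A 0F 1F * A 1F 0F))
      (cong (ℚ._-_ (toℚ (+ 4))) (toℚ-homo-* (A 0F 1F) (A 1F 0F))))))

z≢0⇒∃unit[s*z≤-1] : ∀ z → z ≢ 0ℤ → ∃[ s ] s * s ≡ 1ℤ × s * z ≤ -1ℤ
z≢0⇒∃unit[s*z≤-1] +0       z≢0 = ⊥-elim (z≢0 refl)
z≢0⇒∃unit[s*z≤-1] +[1+ n ] _   = -1ℤ , refl , -≤- z≤n
z≢0⇒∃unit[s*z≤-1] -[1+ n ] _   = 1ℤ , refl , -≤- z≤n

nonPos*nonPos*w<0⇒w<0 : ∀ {u v} w → u ≤ 0ℤ → v ≤ 0ℤ → u * v * w < 0ℤ → w < 0ℤ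
nonPos*nonPos*w<0⇒w<0 {u} {v} w u≤0 v≤0 uvw<0 = ℤₚ.*-cancelˡ-<-nonNeg (u * v) {{ℤ.nonNegative uv≥0}}
  (subst (u * v * w <_) (sym (ℤₚ.*-zeroʳ (u * v))) uvw<0)
  where
  uv≥0 : 0ℤ ≤ u * v
  uv≥0 = subst (_≤ u * v) (ℤₚ.*-zeroʳ u) (ℤₚ.*-monoˡ-≤-nonPos u {{ℤ.nonPositive u≤0}} v≤0)

cycle-rearrangement : ∀ α β γ q r → r * α * (q * γ) * (q * r * β) ≡ q * q * (r * r * (α * β * γ))
cycle-rearrangement = solve-∀ ℤ-Solver.ring

αβγ<0⇒∃signs : ∀ α β γ → α * β * γ < 0ℤ →
  ∃₂ λ q r → 1ℤ + r * α ≤ 0ℤ × q * q + q * γ ≤ 0ℤ × r * r + q * r * β ≤ 0ℤ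
αβγ<0⇒∃signs α β γ αβγ<0 with z≢0⇒∃unit[s*z≤-1] α α≢0 | z≢0⇒∃unit[s*z≤-1] γ γ≢0
  where
  α≢0 : α ≢ 0ℤ
  α≢0 α≡0 = ℤₚ.<-irrefl refl (subst (λ a → a * β * γ < 0ℤ) α≡0 αβγ<0)
  γ≢0 : γ ≢ 0ℤ
  γ≢0 γ≡0 = ℤₚ.<-irrefl (ℤₚ.*-zeroʳ (α * β)) (subst (λ c → α * β * c < 0ℤ) γ≡0 αβγ<0)
... | r , r*r≡1 , rα≤-1 | q , q*q≡1 , qγ≤-1 =
  q , r , 1+[≤-1]≤0 rα≤-1 ,
  subst (λ u → u + q * γ ≤ 0ℤ) (sym q*q≡1) (1+[≤-1]≤0 qγ≤-1) ,
  subst (λ u → u + q * r * β ≤ 0ℤ) (sym r*r≡1) (1+[≤-1]≤0 (ℤₚ.i<j⇒i≤pred[j] qrβ<0))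
  where
  1+[≤-1]≤0 : ∀ {z} → z ≤ -1ℤ → 1ℤ + z ≤ 0ℤ
  1+[≤-1]≤0 = ℤₚ.+-monoʳ-≤ 1ℤ
  qrβ<0 : q * r * β < 0ℤ
  qrβ<0 = nonPos*nonPos*w<0⇒w<0 (q * r * β) (ℤₚ.≤-trans rα≤-1 -≤+) (ℤₚ.≤-trans qγ≤-1 -≤+)
    (subst (_< 0ℤ) (sym product) αβγ<0)
    where
    open ≡-Reasoning
    product : r * α * (q * γ) * (q * r * β) ≡ α * β * γ
    product = begin
      r * α * (q * γ) * (q * r * β)  ≡⟨ cycle-rearrangement α β γ q r ⟩
      q * q * (r * r * (α * β * γ))  ≡⟨ cong₂ (λ u v → u * (v * (α * β * γ))) q*q≡1 r*r≡1 ⟩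
      1ℤ * (1ℤ * (α * β * γ))        ≡⟨ trans (ℤₚ.*-identityˡ _) (ℤₚ.*-identityˡ _) ⟩
      α * β * γ                      ∎

-- The left-hand side is quadForm d A (1 ∷ q ∷ r ∷ []) unfolded, for a 3 × 3 matrix with diagonal
-- entries t₀, t₁, t₂ and A₀₂ = α, A₂₁ = β, A₁₀ = γ (as rationals); the hypotheses on the entries
-- b₀₁, b₁₂, b₂₀ of D A are its symmetry.
form₃-identity : ∀ (d₀ d₁ d₂ α β γ q r t₀ t₁ t₂ b₀₁ b₁₂ b₂₀ : ℚ) →
  t₀ ≡ toℚ (+ 2) → t₁ ≡ toℚ (+ 2) → t₂ ≡ toℚ (+ 2) →
  b₀₁ ≡ d₁ ℚ.* γ → b₁₂ ≡ d₂ ℚ.* β → b₂₀ ≡ d₀ ℚ.* α →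
  (1ℚ ℚ.* (d₀ ℚ.* t₀) ℚ.* 1ℚ ℚ.+ (1ℚ ℚ.* b₀₁ ℚ.* q ℚ.+ (1ℚ ℚ.* (d₀ ℚ.* α) ℚ.* r ℚ.+ 0ℚ)))
  ℚ.+ ((q ℚ.* (d₁ ℚ.* γ) ℚ.* 1ℚ ℚ.+ (q ℚ.* (d₁ ℚ.* t₁) ℚ.* q ℚ.+ (q ℚ.* b₁₂ ℚ.* r ℚ.+ 0ℚ)))
  ℚ.+ ((r ℚ.* b₂₀ ℚ.* 1ℚ ℚ.+ (r ℚ.* (d₂ ℚ.* β) ℚ.* q ℚ.+ (r ℚ.* (d₂ ℚ.* t₂) ℚ.* r ℚ.+ 0ℚ))) ℚ.+ 0ℚ))
  ≡ (d₀ ℚ.+ d₀) ℚ.* (1ℚ ℚ.+ r ℚ.* α) ℚ.+ (d₁ ℚ.+ d₁) ℚ.* (q ℚ.* q ℚ.+ q ℚ.* γ)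
    ℚ.+ (d₂ ℚ.+ d₂) ℚ.* (r ℚ.* r ℚ.+ q ℚ.* r ℚ.* β)
form₃-identity d₀ d₁ d₂ α β γ q r _ _ _ _ _ _ refl refl refl refl refl refl =
  solve (d₀ List.∷ d₁ List.∷ d₂ List.∷ α List.∷ β List.∷ γ List.∷ q List.∷ r List.∷ List.[]) ℚ-ring

positive₃⇒0≤A₀₂A₂₁A₁₀ : (A : Matrix 3) → PositiveQuasiCartan A → + 0 ≤ A 0F 2F * A 2F 1F * A 1F 0F
positive₃⇒0≤A₀₂A₂₁A₁₀ A (d , (diag , d>0 , symm) , posDef) = ℤₚ.≮⇒≥ λ cycle<0 →
  let q , r , X≤0 , Y≤0 , Z≤0 = αβγ<0⇒∃signs α β γ cycle<0 in
  ℚₚ.<-irrefl refl (ℚₚ.<-≤-trans (posDef (x q r) (x≢0 q r)) (subst (ℚ._≤ 0ℚ) (sym (form q r))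
    (ℚₚ.+-mono-≤ (ℚₚ.+-mono-≤ (pos*toℚ-nonPos (2d>0 0F) X≤0) (pos*toℚ-nonPos (2d>0 1F) Y≤0))
      (pos*toℚ-nonPos (2d>0 2F) Z≤0))))
  where
  α = A 0F 2F
  β = A 2F 1F
  γ = A 1F 0F
  2d : Fin 3 → ℚ
  2d s = d s ℚ.+ d s
  2d>0 : ∀ s → 0ℚ ℚ.< 2d s
  2d>0 s = ℚₚ.+-mono-< (d>0 s) (d>0 s)
  x : ℤ → ℤ → Fin 3 → ℚ
  x q r = 1ℚ ∷ toℚ q ∷ toℚ r ∷ []
  x≢0 : ∀ q r → ¬ (∀ s → x q r s ≡ 0ℚ)
  x≢0 q r x≡0 with x≡0 0F
  ... | ()
  form : ∀ q r → quadForm d A (x q r) ≡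
    2d 0F ℚ.* toℚ (1ℤ + r * α) ℚ.+ 2d 1F ℚ.* toℚ (q * q + q * γ) ℚ.+ 2d 2F ℚ.* toℚ (r * r + q * r * β)
  form q r = begin
    quadForm d A (x q r)
      ≡⟨ form₃-identity (d 0F) (d 1F) (d 2F) (toℚ α) (toℚ β) (toℚ γ) (toℚ q) (toℚ r) _ _ _ _ _ _
           (cong toℚ (diag 0F)) (cong toℚ (diag 1F)) (cong toℚ (diag 2F))
           (symm 0F 1F) (symm 1F 2F) (symm 2F 0F) ⟩
    2d 0F ℚ.* (1ℚ ℚ.+ toℚ r ℚ.* toℚ α)
    ℚ.+ 2d 1F ℚ.* (toℚ q ℚ.* toℚ q ℚ.+ toℚ q ℚ.* toℚ γ)
    ℚ.+ 2d 2F ℚ.* (toℚ r ℚ.* toℚ r ℚ.+ toℚ q ℚ.* toℚ r ℚ.* toℚ β)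
      ≡⟨ cong₂ ℚ._+_ (cong₂ ℚ._+_ (cong (2d 0F ℚ.*_) X) (cong (2d 1F ℚ.*_) Y)) (cong (2d 2F ℚ.*_) Z) ⟨
    2d 0F ℚ.* toℚ (1ℤ + r * α) ℚ.+ 2d 1F ℚ.* toℚ (q * q + q * γ)
    ℚ.+ 2d 2F ℚ.* toℚ (r * r + q * r * β) ∎
    where
    open ≡-Reasoning
    X : toℚ (1ℤ + r * α) ≡ 1ℚ ℚ.+ toℚ r ℚ.* toℚ α
    X = trans (toℚ-homo-+ 1ℤ (r * α)) (cong (1ℚ ℚ.+_) (toℚ-homo-* r α))
    Y : toℚ (q * q + q * γ) ≡ toℚ q ℚ.* toℚ q ℚ.+ toℚ q ℚ.* toℚ γ
    Y = trans (toℚ-homo-+ (q * q) (q * γ)) (cong₂ ℚ._+_ (toℚ-homo-* q q) (toℚ-homo-* q γ))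
    Z : toℚ (r * r + q * r * β) ≡ toℚ r ℚ.* toℚ r ℚ.+ toℚ q ℚ.* toℚ r ℚ.* toℚ β
    Z = trans (toℚ-homo-+ (r * r) (q * r * β)) (cong₂ ℚ._+_ (toℚ-homo-* r r)
      (trans (toℚ-homo-* (q * r) β) (cong (ℚ._* toℚ β) (toℚ-homo-* q r))))

lemma2p1 : (n : ℕ) (A : Matrix n) → PositiveQuasiCartan A →
    ((i j : Fin n) → i ≢ j → (+ 0 ≤ A i j * A j i) × (A i j * A j i ≤ + 3))
    × ((i j k : Fin n) → i ≢ j → j ≢ k → i ≢ k → + 0 ≤ A i k * A k j * A j i)
lemma2p1 n A positive@(_ , (_ , d>0 , symm) , _) = pairs , triples
  where
  pairs : (i j : Fin n) → i ≢ j → (+ 0 ≤ A i j * A j i) × (A i j * A j i ≤ + 3)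
  pairs i j i≢j = symmetrizable⇒0≤AᵢⱼAⱼᵢ A d>0 symm i j ,
    positive₂⇒A₀₁A₁₀≤3 (submatrix ι A) (PositiveQuasiCartan-submatrix A ι-inj positive)
    where
    ι = i ∷ j ∷ []
    ι-inj : Injective _≡_ _≡_ ι
    ι-inj = ∷-injective (λ { 0F → i≢j ∘ sym }) (∷-injective (λ ()) []-injective)

  triples : (i j k : Fin n) → i ≢ j → j ≢ k → i ≢ k → + 0 ≤ A i k * A k j * A j i
  triples i j k i≢j j≢k i≢k =
    positive₃⇒0≤A₀₂A₂₁A₁₀ (submatrix ι A) (PositiveQuasiCartan-submatrix A ι-inj positive)
    where
    ι = i ∷ j ∷ k ∷ []
    ι-inj : Injective _≡_ _≡_ ι
    ι-inj = ∷-injective (λ { 0F → i≢j ∘ sym ; 1F → i≢k ∘ sym })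
      (∷-injective (λ { 0F → j≢k ∘ sym }) (∷-injective (λ ()) []-injective))
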